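{- For every integer $n\geq 1$, \[ (2n-1)!\,(2n-2)!\,(3n-3)!\ \Bigm|\ (6n-5)!\,(n-1)!. \]
   Context: For integers $a\neq 0$ and $b$, $a\mid b$ means that $b/a$ is an integer. -}

module Defs where

-- By Legendre's formula the exponent of a prime p in n! is ∑_{j ≥ 1} ⌊n / p^j⌋, so a product
-- of factorials ∏ aᵢ! divides ∏ bⱼ! as soon as ∑ ⌊aᵢ / q⌋ ≤ ∑ ⌊bⱼ / q⌋ for every q ≥ 1.
-- For n = m + 1 the inequality needed is
--   ⌊(2m+1)/q⌋ + ⌊2m/q⌋ + ⌊3m/q⌋ ≤ ⌊(6m+1)/q⌋ + ⌊m/q⌋,
-- and writing m = tq + r with r < q both sides shift by 7t, leaving the case m = r < q,
-- which is a small case analysis on whether 2r < q.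

module Submission where

open import Defs
open import Data.Nat using (ℕ; _*_; _∸_; _≤_; _!)
open import Data.Nat.Divisibility using (_∣_)

open import Data.Nat
open import Data.Nat.Properties
open import Data.Nat.DivMod
open import Data.Nat.Divisibility
open import Data.Nat.Primality using (Prime; euclidsLemma; prime⇒nonZero; prime⇒nonTrivial)
open import Data.Nat.Primality.Factorisation using (factorise)
open import Data.Nat.Induction using (<-rec)
open import Data.Nat.ListAction using (sum; product)
open import Data.Nat.Tactic.RingSolver using (solve-∀)
open import Data.List.Base using ([]; _∷_; map)
open import Data.List.Relation.Unary.All using (_∷_)
open import Data.Product.Base using (∃-syntax; _×_; _,_; proj₁)
open import Data.Sum.Base using (inj₁; inj₂; [_,_])
open import Function.Base using (_∘_)
open import Function.Bundles using (_⇔_; mk⇔; Equivalence)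
open import Relation.Nullary using (Dec; yes; no; contradiction)
open import Relation.Binary.PropositionalEquality
  using (_≡_; refl; sym; trans; cong; cong₂; subst; subst₂; module ≡-Reasoning)
open import Algebra.Properties.CommutativeSemigroup +-commutativeSemigroup using (interchange)

private
  variable
    A B : Set
    f g : ℕ → ℕ

∑ : ℕ → (ℕ → ℕ) → ℕ
∑ zero    f = 0
∑ (suc n) f = f (suc n) + ∑ n f

∑-cong : ∀ n → (∀ i → f i ≡ g i) → ∑ n f ≡ ∑ n g
∑-cong zero    f≗g = refl
∑-cong (suc n) f≗g = cong₂ _+_ (f≗g (suc n)) (∑-cong n f≗g)

∑-mono-≤ : ∀ n → (∀ i → f i ≤ g i) → ∑ n f ≤ ∑ n g
∑-mono-≤ zero    f≤g = z≤n
∑-mono-≤ (suc n) f≤g = +-mono-≤ (f≤g (suc n)) (∑-mono-≤ n f≤g)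

∑-distrib-+ : ∀ n → ∑ n (λ i → f i + g i) ≡ ∑ n f + ∑ n g
∑-distrib-+         zero    = refl
∑-distrib-+ {f} {g} (suc n) =
  trans (cong (f (suc n) + g (suc n) +_) (∑-distrib-+ {f} {g} n))
        (interchange (f (suc n)) (g (suc n)) (∑ n f) (∑ n g))

∑-zero : ∀ n → ∑ n (λ _ → 0) ≡ 0
∑-zero zero    = refl
∑-zero (suc n) = ∑-zero n

𝟙 : Dec A → ℕ
𝟙 (yes _) = 1
𝟙 (no _)  = 0

𝟙-cong : A ⇔ B → (a? : Dec A) (b? : Dec B) → 𝟙 a? ≡ 𝟙 b?
𝟙-cong A⇔B (yes _) (yes _) = refl
𝟙-cong A⇔B (yes a) (no ¬b) = contradiction (Equivalence.to A⇔B a) ¬b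
𝟙-cong A⇔B (no ¬a) (yes b) = contradiction (Equivalence.from A⇔B b) ¬a
𝟙-cong A⇔B (no _)  (no _)  = refl

∑-𝟙-≤ : ∀ n t → ∑ n (λ j → 𝟙 (j ≤? t)) ≡ n ⊓ t
∑-𝟙-≤ zero    t = refl
∑-𝟙-≤ (suc n) t with suc n ≤? t
... | yes n<t = begin
  suc (∑ n (λ j → 𝟙 (j ≤? t))) ≡⟨ cong suc (∑-𝟙-≤ n t) ⟩
  suc (n ⊓ t)                   ≡⟨ cong suc (m≤n⇒m⊓n≡m (<⇒≤ n<t)) ⟩
  suc n                         ≡⟨ m≤n⇒m⊓n≡m n<t ⟨
  suc n ⊓ t                     ∎
  where open ≡-Reasoning
... | no n≮t = begin
  ∑ n (λ j → 𝟙 (j ≤? t)) ≡⟨ ∑-𝟙-≤ n t ⟩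
  n ⊓ t                  ≡⟨ m≥n⇒m⊓n≡n t≤n ⟩
  t                      ≡⟨ m≥n⇒m⊓n≡n (m≤n⇒m≤1+n t≤n) ⟨
  suc n ⊓ t              ∎
  where
  open ≡-Reasoning
  t≤n : t ≤ n
  t≤n = ≤-pred (≰⇒> n≮t)

*≤⇒≤/ : ∀ {a n} q .{{_ : NonZero q}} → a * q ≤ n → a ≤ n / q
*≤⇒≤/ {a} {n} q a*q≤n = subst (_≤ n / q) (m*n/n≡m a q) (/-monoˡ-≤ q a*q≤n)

/-unique : ∀ {a n} q .{{_ : NonZero q}} → a * q ≤ n → n < suc a * q → n / q ≡ a
/-unique q lo hi = ≤-antisym (≤-pred (m<n*o⇒m/o<n hi)) (*≤⇒≤/ q lo)

m<[1+m/n]*n : ∀ m n .{{_ : NonZero n}} → m < suc (m / n) * n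
m<[1+m/n]*n m n = begin-strict
  m                 ≡⟨ m≡m%n+[m/n]*n m n ⟩
  m % n + m / n * n <⟨ +-monoˡ-< (m / n * n) (m%n<n m n) ⟩
  n + m / n * n     ∎
  where open ≤-Reasoning

[m+kn]/n≡m/n+k : ∀ m k n .{{_ : NonZero n}} → (m + k * n) / n ≡ m / n + k
[m+kn]/n≡m/n+k m k n = trans (+-distrib-/-∣ʳ m (n∣m*n k)) (cong (m / n +_) (m*n/n≡m k n))

1+n/q≡[q∣1+n]+n/q : ∀ n q .{{_ : NonZero q}} → suc n / q ≡ 𝟙 (q ∣? suc n) + n / q
1+n/q≡[q∣1+n]+n/q n q with q ∣? suc n
... | no q∤1+n =
  /-unique q (≤-trans (m/n*n≤m n q) (n≤1+n n))
             (≤∧≢⇒< (m<[1+m/n]*n n q) (q∤1+n ∘ divides (suc (n / q))))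
... | yes (divides (suc k) 1+n≡[1+k]q) = begin
  suc n / q       ≡⟨ /-congˡ 1+n≡[1+k]q ⟩
  suc k * q / q   ≡⟨ m*n/n≡m (suc k) q ⟩
  suc k           ≡⟨ cong suc (/-unique q kq≤n (subst (n <_) 1+n≡[1+k]q ≤-refl)) ⟨
  suc (n / q)     ∎
  where
  open ≡-Reasoning
  kq≤n : k * q ≤ n
  kq≤n = ≤-pred (subst (suc (k * q) ≤_) (sym 1+n≡[1+k]q) (+-monoˡ-≤ (k * q) (>-nonZero⁻¹ q)))

n<m^n : ∀ {m} → 1 < m → ∀ n → n < m ^ n
n<m^n     1<m zero    = z<s
n<m^n {m} 1<m (suc n) = begin-strict
  suc n           ≤⟨ n<m^n 1<m n ⟩
  m ^ n           <⟨ m<m*n (m ^ n) m 1<m ⟩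
  m ^ n * m       ≡⟨ *-comm (m ^ n) m ⟩
  m * m ^ n       ∎
  where
  open ≤-Reasoning
  instance _ = m^n≢0 m n {{>-nonZero (<-trans z<s 1<m)}}

^-monoʳ-∣ : ∀ m {i j} → i ≤ j → m ^ i ∣ m ^ j
^-monoʳ-∣ m {i} {j} i≤j = divides (m ^ (j ∸ i)) (begin
  m ^ j               ≡⟨ cong (m ^_) (m+[n∸m]≡n i≤j) ⟨
  m ^ (i + (j ∸ i))   ≡⟨ ^-distribˡ-+-* m i (j ∸ i) ⟩
  m ^ i * m ^ (j ∸ i) ≡⟨ *-comm (m ^ i) (m ^ (j ∸ i)) ⟩
  m ^ (j ∸ i) * m ^ i ∎)
  where open ≡-Reasoning

∤⇒nonZero : ∀ {m n} → m ∤ n → NonZero n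
∤⇒nonZero {m} {zero}  m∤0 = contradiction (m ∣0) m∤0
∤⇒nonZero {m} {suc n} _   = _

∏!≢0 : ∀ as → NonZero (product (map _! as))
∏!≢0 []       = _
∏!≢0 (a ∷ as) = m*n≢0 (a !) _ {{a !≢0}} {{∏!≢0 as}}

module Valuation {p : ℕ} (p-prime : Prime p) where

  instance
    p≢0 : NonZero p
    p≢0 = prime⇒nonZero p-prime

  1<p : 1 < p
  1<p = nonTrivial⇒n>1 p {{prime⇒nonTrivial p-prime}}

  ^∣*-cancelʳ : ∀ t {m n} → p ∤ n → p ^ t ∣ m * n → p ^ t ∣ m
  ^∣*-cancelʳ zero    p∤n _ = 1∣ _
  ^∣*-cancelʳ (suc t) {m} {n} p∤n p^[1+t]∣mn
    with euclidsLemma m n p-prime (∣-trans (m∣m*n (p ^ t)) p^[1+t]∣mn)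
  ... | inj₂ p∣n = contradiction p∣n p∤n
  ... | inj₁ (divides m′ refl) =
    subst (p ^ suc t ∣_) (*-comm p m′) (*-monoʳ-∣ p (^∣*-cancelʳ t p∤n p^t∣m′n))
    where
    p^t∣m′n : p ^ t ∣ m′ * n
    p^t∣m′n = *-cancelˡ-∣ p (subst (p ^ suc t ∣_) (rearrange m′ p n) p^[1+t]∣mn)
      where
      rearrange : ∀ a b c → a * b * c ≡ b * (a * c)
      rearrange = solve-∀

  Decomposition : ℕ → Set
  Decomposition x = ∃[ t ] ∃[ u ] x ≡ p ^ t * u × p ∤ u

  decompose : ∀ x .{{_ : NonZero x}} → Decomposition x
  decompose = <-rec (λ x → .{{NonZero x}} → Decomposition x) step
    where
    step : ∀ x → (∀ {y} → y < x → .{{NonZero y}} → Decomposition y) →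
           .{{NonZero x}} → Decomposition x
    step x rec with p ∣? x
    ... | no p∤x = 0 , x , sym (*-identityˡ x) , p∤x
    ... | yes (divides y refl) with rec {y} (m<m*n y p {{m*n≢0⇒m≢0 y}} 1<p) {{m*n≢0⇒m≢0 y}}
    ...   | t , u , refl , p∤u = suc t , u , trans (*-comm _ p) (sym (*-assoc p (p ^ t) u)) , p∤u

  ^∣⇔≤ : ∀ {x} j ((t , _) : Decomposition x) → p ^ j ∣ x ⇔ j ≤ t
  ^∣⇔≤ j (t , u , refl , p∤u) =
    mk⇔ ^∣⇒≤ (λ j≤t → ∣-trans (^-monoʳ-∣ p {j} j≤t) (m∣m*n u))
    where
    ^∣⇒≤ : p ^ j ∣ p ^ t * u → j ≤ t
    ^∣⇒≤ p^j∣x = ≮⇒≥ {t} {j} λ t<j → p∤u (*-cancelˡ-∣ (p ^ t) {{m^n≢0 p t}}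
      (subst (_∣ p ^ t * u) (*-comm p (p ^ t)) (∣-trans (^-monoʳ-∣ p {suc t} t<j) p^j∣x)))

  exponent≤ : ∀ {x} ((t , _) : Decomposition x) → t ≤ x
  exponent≤ (t , u , refl , p∤u) =
    ≤-trans (<⇒≤ (n<m^n 1<p t)) (m≤m*n (p ^ t) u {{∤⇒nonZero p∤u}})

  -- The exponent of p in x: the j ≥ 1 with p ^ j ∣ x form an initial segment of
  -- [1, x] when x ≢ 0.  (ν 0 = 0 is a junk value.)
  ν : ℕ → ℕ
  ν x = ∑ x (λ j → 𝟙 (p ^ j ∣? x))

  ∑-^∣ : ∀ K {x} ((t , _) : Decomposition x) → ∑ K (λ j → 𝟙 (p ^ j ∣? x)) ≡ K ⊓ t
  ∑-^∣ K {x} d@(t , _) = begin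
    ∑ K (λ j → 𝟙 (p ^ j ∣? x)) ≡⟨ ∑-cong K (λ j → 𝟙-cong (^∣⇔≤ j d) _ _) ⟩
    ∑ K (λ j → 𝟙 (j ≤? t))     ≡⟨ ∑-𝟙-≤ K t ⟩
    K ⊓ t                      ∎
    where open ≡-Reasoning

  ν-decomposition : ∀ {x} ((t , _) : Decomposition x) → ν x ≡ t
  ν-decomposition d = trans (∑-^∣ _ d) (m≥n⇒m⊓n≡n (exponent≤ d))

  ν[1]≡0 : ν 1 ≡ 0
  ν[1]≡0 = ν-decomposition (0 , 1 , refl , >⇒∤ 1<p)

  ^∣⇔≤ν : ∀ {x} .{{_ : NonZero x}} j → p ^ j ∣ x ⇔ j ≤ ν x
  ^∣⇔≤ν {x} j = subst (λ s → p ^ j ∣ x ⇔ j ≤ s) (sym (ν-decomposition d)) (^∣⇔≤ j d)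
    where d = decompose x

  ∑-^∣≡ν : ∀ {x K} .{{_ : NonZero x}} → x ≤ K → ∑ K (λ j → 𝟙 (p ^ j ∣? x)) ≡ ν x
  ∑-^∣≡ν {x} {K} x≤K = begin
    ∑ K (λ j → 𝟙 (p ^ j ∣? x)) ≡⟨ ∑-^∣ K d ⟩
    K ⊓ t                      ≡⟨ m≥n⇒m⊓n≡n (≤-trans (exponent≤ d) x≤K) ⟩
    t                          ≡⟨ ν-decomposition d ⟨
    ν x                        ∎
    where
    open ≡-Reasoning
    d = decompose x
    t = proj₁ d

  ν-* : ∀ x y .{{_ : NonZero x}} .{{_ : NonZero y}} → ν (x * y) ≡ ν x + ν y
  ν-* x y with decompose x | decompose y
  ... | dx@(t , u , x≡ , p∤u) | dy@(s , v , y≡ , p∤v) = begin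
    ν (x * y) ≡⟨ ν-decomposition (t + s , u * v , xy≡ , p∤uv) ⟩
    t + s     ≡⟨ cong₂ _+_ (ν-decomposition dx) (ν-decomposition dy) ⟨
    ν x + ν y ∎
    where
    open ≡-Reasoning
    p∤uv : p ∤ u * v
    p∤uv = [ p∤u , p∤v ] ∘ euclidsLemma u v p-prime
    interchange′ : ∀ a b c d → a * b * (c * d) ≡ a * c * (b * d)
    interchange′ = solve-∀
    xy≡ : x * y ≡ p ^ (t + s) * (u * v)
    xy≡ = begin
      x * y                   ≡⟨ cong₂ _*_ x≡ y≡ ⟩
      p ^ t * u * (p ^ s * v) ≡⟨ interchange′ (p ^ t) u (p ^ s) v ⟩
      p ^ t * p ^ s * (u * v) ≡⟨ cong (_* (u * v)) (^-distribˡ-+-* p t s) ⟨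
      p ^ (t + s) * (u * v)   ∎

  _/p^_ : ℕ → ℕ → ℕ
  n /p^ j = (n / p ^ j) {{m^n≢0 p j}}

  ν-! : ∀ {n K} → n ≤ K → ν (n !) ≡ ∑ K (n /p^_)
  ν-! {zero} {K} _ = begin
    ν 1           ≡⟨ ν[1]≡0 ⟩
    0             ≡⟨ ∑-zero K ⟨
    ∑ K (λ _ → 0) ≡⟨ ∑-cong K (λ j → 0/n≡0 (p ^ j) {{m^n≢0 p j}}) ⟨
    ∑ K (0 /p^_)  ∎
    where open ≡-Reasoning
  ν-! {suc n} {K} 1+n≤K = begin
    ν (suc n * n !)
      ≡⟨ ν-* (suc n) (n !) {{_}} {{n !≢0}} ⟩
    ν (suc n) + ν (n !)
      ≡⟨ cong₂ _+_ (sym (∑-^∣≡ν 1+n≤K)) (ν-! (≤-trans (n≤1+n n) 1+n≤K)) ⟩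
    ∑ K (λ j → 𝟙 (p ^ j ∣? suc n)) + ∑ K (n /p^_)
      ≡⟨ ∑-distrib-+ K ⟨
    ∑ K (λ j → 𝟙 (p ^ j ∣? suc n) + n /p^ j)
      ≡⟨ ∑-cong K (λ j → 1+n/q≡[q∣1+n]+n/q n (p ^ j) {{m^n≢0 p j}}) ⟨
    ∑ K (suc n /p^_)
      ∎
    where open ≡-Reasoning

  ν-∏! : ∀ as {K} → sum as ≤ K →
         ν (product (map _! as)) ≡ ∑ K (λ j → sum (map (_/p^ j) as))
  ν-∏! []       {K} _ = trans ν[1]≡0 (sym (∑-zero K))
  ν-∏! (a ∷ as) {K} a+Σas≤K = begin
    ν (a ! * product (map _! as))
      ≡⟨ ν-* (a !) _ {{a !≢0}} {{∏!≢0 as}} ⟩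
    ν (a !) + ν (product (map _! as))
      ≡⟨ cong₂ _+_ (ν-! (m+n≤o⇒m≤o a a+Σas≤K)) (ν-∏! as (m+n≤o⇒n≤o a a+Σas≤K)) ⟩
    ∑ K (a /p^_) + ∑ K (λ j → sum (map (_/p^ j) as))
      ≡⟨ ∑-distrib-+ K ⟨
    ∑ K (λ j → a /p^ j + sum (map (_/p^ j) as))
      ∎
    where open ≡-Reasoning

prime-divisor : ∀ {n} → 1 < n → ∃[ p ] Prime p × p ∣ n
prime-divisor {1} (s≤s ())
prime-divisor {n@(suc (suc _))} _ with factorise n
... | record { factors = p ∷ ps ; isFactorisation = n≡ ; factorsPrime = p-prime ∷ _ } =
  p , p-prime , divides (product ps) (trans n≡ (*-comm p (product ps)))

-- Strong induction on a: write a = p ^ t * u with p ∤ u for a prime p ∣ a; then u ∣ b by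
-- induction, say b = c * u, and p ^ t ∣ c * u forces p ^ t ∣ c.
prime-powers-∣⇒∣ : ∀ {a b} .{{_ : NonZero a}} →
                   (∀ {p} k → Prime p → p ^ k ∣ a → p ^ k ∣ b) → a ∣ b
prime-powers-∣⇒∣ {a} {b} = <-rec Goal step a
  where
  Goal : ℕ → Set
  Goal a = .{{NonZero a}} → (∀ {p} k → Prime p → p ^ k ∣ a → p ^ k ∣ b) → a ∣ b

  step : ∀ a → (∀ {u} → u < a → Goal u) → Goal a
  step (suc zero) _ _ = 1∣ b
  step a@(suc (suc _)) rec prime-powers with prime-divisor {a} (s<s z<s)
  ... | p , p-prime , p∣a with Valuation.decompose p-prime a
  ...   | d@(t , u , a≡ , p∤u) = begin
    a         ≡⟨ a≡ ⟩
    p ^ t * u ∣⟨ *-monoˡ-∣ u p^t∣c ⟩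
    c * u     ≡⟨ b≡ ⟨
    b         ∎
    where
    open ∣-Reasoning
    open Valuation p-prime using (^∣⇔≤; 1<p; ^∣*-cancelʳ)
    instance
      u≢0 : NonZero u
      u≢0 = ∤⇒nonZero p∤u
    u∣a : u ∣ a
    u∣a = divides (p ^ t) a≡
    0<t : 0 < t
    0<t = Equivalence.to (^∣⇔≤ 1 d) (subst (_∣ a) (sym (*-identityʳ p)) p∣a)
    u<a : u < a
    u<a = subst (u <_) (trans (*-comm u (p ^ t)) (sym a≡)) (m<m*n u (p ^ t) (^-monoʳ-< p 1<p 0<t))
    u∣b : u ∣ b
    u∣b = rec u<a (λ k q-prime q^k∣u → prime-powers k q-prime (∣-trans q^k∣u u∣a))
    c = quotient u∣b
    b≡ : b ≡ c * u
    b≡ = m∣n⇒n≡quotient*m u∣b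
    p^t∣c : p ^ t ∣ c
    p^t∣c = ^∣*-cancelʳ t p∤u (subst (p ^ t ∣_) b≡
              (prime-powers t p-prime (divides u (trans a≡ (*-comm (p ^ t) u)))))

∏!∣∏! : ∀ as bs → (∀ q .{{_ : NonZero q}} → sum (map (_/ q) as) ≤ sum (map (_/ q) bs)) →
        product (map _! as) ∣ product (map _! bs)
∏!∣∏! as bs floor-sums = prime-powers-∣⇒∣ {{∏!≢0 as}} λ {p} k p-prime →
  let open Valuation p-prime
      K = sum as + sum bs
      ν-∏!-≤ : ν (product (map _! as)) ≤ ν (product (map _! bs))
      ν-∏!-≤ = begin
        ν (product (map _! as))           ≡⟨ ν-∏! as (m≤m+n (sum as) (sum bs)) ⟩
        ∑ K (λ j → sum (map (_/p^ j) as)) ≤⟨ ∑-mono-≤ K (λ j → floor-sums (p ^ j) {{m^n≢0 p j}}) ⟩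
        ∑ K (λ j → sum (map (_/p^ j) bs)) ≡⟨ ν-∏! bs (m≤n+m (sum bs) (sum as)) ⟨
        ν (product (map _! bs))           ∎
  in λ p^k∣∏as → Equivalence.from (^∣⇔≤ν {{∏!≢0 bs}} k)
                   (≤-trans (Equivalence.to (^∣⇔≤ν {{∏!≢0 as}} k) p^k∣∏as) ν-∏!-≤)
  where open ≤-Reasoning

remainder-inequality : ∀ {r q} .{{_ : NonZero q}} → r < q →
  (2 * r + 1) / q + (2 * r) / q + (3 * r) / q ≤ (6 * r + 1) / q
remainder-inequality {r} {q} r<q = *≤⇒≤/ q bound
  where
  open ≤-Reasoning
  c = (2 * r + 1) / q
  d = (2 * r) / q
  e = (3 * r) / q

  eq≤3r : e * q ≤ 3 * r
  eq≤3r = m/n*n≤m (3 * r) q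

  2r+1<2q : 2 * r + 1 < 2 * q
  2r+1<2q = begin-strict
    2 * r + 1       <⟨ n<1+n (2 * r + 1) ⟩
    suc (2 * r + 1) ≡⟨ 2[1+r] r ⟨
    2 * suc r       ≤⟨ *-monoʳ-≤ 2 r<q ⟩
    2 * q           ∎
    where
    2[1+r] : ∀ r → 2 * suc r ≡ suc (2 * r + 1)
    2[1+r] = solve-∀

  -- If 2r < q then d = 0 and the bounds on c and e suffice; otherwise c, d ≤ 1 and
  -- e is either ≤ 1 or large enough that 2 + e ≤ 2e.
  bound : (c + d + e) * q ≤ 6 * r + 1
  bound with 2 * r <? q
  ... | yes 2r<q = begin
    (c + d + e) * q     ≡⟨ cong (λ d → (c + d + e) * q) (m<n⇒m/n≡0 2r<q) ⟩
    (c + 0 + e) * q     ≡⟨ cong (λ c → (c + e) * q) (+-identityʳ c) ⟩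
    (c + e) * q         ≡⟨ *-distribʳ-+ q c e ⟩
    c * q + e * q       ≤⟨ +-mono-≤ (m/n*n≤m (2 * r + 1) q) eq≤3r ⟩
    2 * r + 1 + 3 * r   ≡⟨ collect r ⟩
    5 * r + 1           ≤⟨ +-monoˡ-≤ 1 (*-monoˡ-≤ r (n≤1+n 5)) ⟩
    6 * r + 1           ∎
    where
    collect : ∀ r → 2 * r + 1 + 3 * r ≡ 5 * r + 1
    collect = solve-∀
  ... | no 2r≮q = begin
    (c + d + e) * q ≤⟨ *-monoˡ-≤ q (+-monoˡ-≤ e c+d≤2) ⟩
    (2 + e) * q     ≤⟨ [2+e]q≤6r ⟩
    6 * r           ≤⟨ m≤m+n (6 * r) 1 ⟩
    6 * r + 1       ∎
    where
    c+d≤2 : c + d ≤ 2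
    c+d≤2 = +-mono-≤ (≤-pred (m<n*o⇒m/o<n {n = 2} 2r+1<2q))
                     (≤-pred (m<n*o⇒m/o<n {n = 2} (≤-<-trans (m≤m+n (2 * r) 1) 2r+1<2q)))
    [2+e]q≤6r : (2 + e) * q ≤ 6 * r
    [2+e]q≤6r with e ≤? 1
    ... | yes e≤1 = begin
      (2 + e) * q ≤⟨ *-monoˡ-≤ q (+-monoʳ-≤ 2 e≤1) ⟩
      3 * q       ≤⟨ *-monoʳ-≤ 3 (≮⇒≥ 2r≮q) ⟩
      3 * (2 * r) ≡⟨ *-assoc 3 2 r ⟨
      6 * r       ∎
    ... | no e≰1 = begin
      (2 + e) * q   ≤⟨ *-monoˡ-≤ q (+-monoˡ-≤ e (≰⇒> e≰1)) ⟩
      (e + e) * q   ≡⟨ double e q ⟩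
      2 * (e * q)   ≤⟨ *-monoʳ-≤ 2 eq≤3r ⟩
      2 * (3 * r)   ≡⟨ *-assoc 2 3 r ⟨
      6 * r         ∎
      where
      double : ∀ e q → (e + e) * q ≡ 2 * (e * q)
      double = solve-∀

floor-inequality : ∀ m q .{{_ : NonZero q}} →
  (2 * m + 1) / q + (2 * m) / q + (3 * m) / q ≤ (6 * m + 1) / q + m / q
floor-inequality m q = begin
  (2 * m + 1) / q + (2 * m) / q + (3 * m) / q
    ≡⟨ cong₂ _+_ (cong₂ _+_ (shift 2 1) (shift₀ 2)) (shift₀ 3) ⟩
  ((2 * r + 1) / q + 2 * t) + ((2 * r) / q + 2 * t) + ((3 * r) / q + 3 * t)
    ≡⟨ regroup ((2 * r + 1) / q) ((2 * r) / q) ((3 * r) / q) t ⟩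
  (2 * r + 1) / q + (2 * r) / q + (3 * r) / q + 7 * t
    ≤⟨ +-monoˡ-≤ (7 * t) (remainder-inequality (m%n<n m q)) ⟩
  (6 * r + 1) / q + 7 * t
    ≡⟨ split-off ((6 * r + 1) / q) t ⟩
  (6 * r + 1) / q + 6 * t + t
    ≡⟨ cong (_+ t) (shift 6 1) ⟨
  (6 * m + 1) / q + m / q
    ∎
  where
  open ≤-Reasoning
  r = m % q
  t = m / q
  shift : ∀ a b → (a * m + b) / q ≡ (a * r + b) / q + a * t
  shift a b = begin-equality
    (a * m + b) / q               ≡⟨ /-congˡ (cong (λ m → a * m + b) (m≡m%n+[m/n]*n m q)) ⟩
    (a * (r + t * q) + b) / q     ≡⟨ /-congˡ (expand a b r t q) ⟩
    (a * r + b + a * t * q) / q   ≡⟨ [m+kn]/n≡m/n+k (a * r + b) (a * t) q ⟩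
    (a * r + b) / q + a * t       ∎
    where
    expand : ∀ a b r t q → a * (r + t * q) + b ≡ a * r + b + a * t * q
    expand = solve-∀
  shift₀ : ∀ a → (a * m) / q ≡ (a * r) / q + a * t
  shift₀ a = subst₂ (λ x y → x / q ≡ y / q + a * t)
                    (+-identityʳ (a * m)) (+-identityʳ (a * r)) (shift a 0)
  regroup : ∀ c d e t → (c + 2 * t) + (d + 2 * t) + (e + 3 * t) ≡ c + d + e + 7 * t
  regroup = solve-∀
  split-off : ∀ x t → x + 7 * t ≡ x + 6 * t + t
  split-off = solve-∀

[2m+1]![2m]![3m]!∣[6m+1]!m! : ∀ m → (2 * m + 1) ! * (2 * m) ! * (3 * m) ! ∣ (6 * m + 1) ! * m !
[2m+1]![2m]![3m]!∣[6m+1]!m! m =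
  subst₂ _∣_ (∏₃ ((2 * m + 1) !) ((2 * m) !) ((3 * m) !)) (∏₂ ((6 * m + 1) !) (m !))
    (∏!∣∏! (2 * m + 1 ∷ 2 * m ∷ 3 * m ∷ []) (6 * m + 1 ∷ m ∷ []) λ q →
      subst₂ _≤_ (∑₃ ((2 * m + 1) / q) ((2 * m) / q) ((3 * m) / q)) (∑₂ ((6 * m + 1) / q) (m / q))
        (floor-inequality m q))
  where
  ∏₃ : ∀ x y z → x * (y * (z * 1)) ≡ x * y * z
  ∏₃ = solve-∀
  ∏₂ : ∀ x y → x * (y * 1) ≡ x * y
  ∏₂ = solve-∀
  ∑₃ : ∀ x y z → x + y + z ≡ x + (y + (z + 0))
  ∑₃ = solve-∀
  ∑₂ : ∀ x y → x + y ≡ x + (y + 0)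
  ∑₂ = solve-∀

*-suc-∸ : ∀ k m {j} → j ≤ k → k * suc m ∸ j ≡ k * m + (k ∸ j)
*-suc-∸ k m {j} j≤k =
  trans (cong (_∸ j) (trans (*-suc k m) (+-comm k (k * m)))) (+-∸-assoc (k * m) j≤k)

lemma2p6 : (n : ℕ) → 1 ≤ n →
    ((2 * n ∸ 1) ! * (2 * n ∸ 2) !) * (3 * n ∸ 3) ! ∣ (6 * n ∸ 5) ! * (n ∸ 1) !
lemma2p6 (suc m) _ =
  subst₂ _∣_ (cong₂ _*_ (cong₂ _*_ (cong _! 2m+1≡) (cong _! 2m≡)) (cong _! 3m≡))
             (cong (λ x → x ! * m !) 6m+1≡)
             ([2m+1]![2m]![3m]!∣[6m+1]!m! m)
  where
  2m+1≡ : 2 * m + 1 ≡ 2 * suc m ∸ 1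
  2m+1≡ = sym (*-suc-∸ 2 m (n≤1+n 1))
  2m≡ : 2 * m ≡ 2 * suc m ∸ 2
  2m≡ = sym (trans (*-suc-∸ 2 m ≤-refl) (+-identityʳ (2 * m)))
  3m≡ : 3 * m ≡ 3 * suc m ∸ 3
  3m≡ = sym (trans (*-suc-∸ 3 m ≤-refl) (+-identityʳ (3 * m)))
  6m+1≡ : 6 * m + 1 ≡ 6 * suc m ∸ 5
  6m+1≡ = sym (*-suc-∸ 6 m (n≤1+n 5))
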